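{- Let $G=(V,E)$ be a finite, simple, undirected, connected graph with at least two vertices, and let $X \subseteq V$ with $|X| = 2$ be such that $G[V\setminus X]$ is a disjoint union of cliques. Then $\chi_{ON}(G) \leq 3$.
   Context: A CFON coloring of a graph $G=(V,E)$ with $k$ colors is a map $C: V \to \{1,\dots,k\}$ such that for every $v \in V$ there is a color $i$ with $|N(v)\cap C^{ -1}(i)| = 1$, where $N(v)$ is the open neighborhood of $v$. $\chi_{ON}(G)$ is the minimum $k$ for which a CFON coloring with $k$ colors exists. -}

module Defs where

open import Data.Nat using (ℕ; zero; suc; _≤_)
open import Data.Fin using (Fin)
open import Data.Fin.Properties using (_≟_)
open import Data.Bool using (Bool; true; false; _∧_; T?)
open import Data.List using (List; []; _∷_; filter; length; allFin)
open import Data.Product using (Σ; ∃; ∃-syntax; _×_; _,_)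
open import Relation.Binary.PropositionalEquality using (_≡_; _≢_)
open import Relation.Nullary using (¬_; Dec; yes; no; does)
open import Function using (_⇔_)

record Graph (n : ℕ) : Set where
  field
    adj   : Fin n → Fin n → Bool
    sym   : ∀ u v → adj u v ≡ adj v u
    loopless : ∀ v → adj v v ≡ false
open Graph public

Adj : ∀ {n} → Graph n → Fin n → Fin n → Set
Adj G u v = adj G u v ≡ true

data Walk {n : ℕ} (G : Graph n) : Fin n → Fin n → Set where
  here : ∀ {u} → Walk G u u
  step : ∀ {u w v} → Adj G u w → Walk G w v → Walk G u v

Connected : ∀ {n} → Graph n → Set
Connected {n} G = ∀ (u v : Fin n) → Walk G u v

DisjointUnionOfCliquesOutside : ∀ {n} → Graph n → Fin n → Fin n → Set
DisjointUnionOfCliquesOutside {n} G x₁ x₂ =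
  Σ (Fin n → ℕ) λ cl → ∀ (u v : Fin n) →
    u ≢ x₁ → u ≢ x₂ → v ≢ x₁ → v ≢ x₂ → u ≢ v →
    (Adj G u v ⇔ (cl u ≡ cl v))

count : ∀ {n} → (Fin n → Bool) → ℕ
count {n} p = length (filter (λ u → T? (p u)) (allFin n))

nbrCount : ∀ {n k} → Graph n → (Fin n → Fin k) → Fin n → Fin k → ℕ
nbrCount G C v i = count (λ u → adj G v u ∧ does (C u ≟ i))

IsCFON : ∀ {n k} → Graph n → (Fin n → Fin k) → Set
IsCFON {n} {k} G C = ∀ (v : Fin n) → ∃[ i ] nbrCount G C v i ≡ 1

-- χ_ON(G) ≤ k  iff  some CFON colouring with k colours exists
-- (colours need not all be used, so existence with k colours is equivalent
-- to the minimum being ≤ k).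
χON≤ : ∀ {n} → Graph n → ℕ → Set
χON≤ {n} G k = Σ (Fin n → Fin k) λ C → IsCFON G C

-- Colour x₁ and x₂ first. A clique K of G − X can then be coloured on its own: a vertex a of K
-- carrying a colour that x₁ and x₂ do not carry is the unique witness of every other vertex of K,
-- and a itself is served by a second such vertex of K or by x₁ or x₂; by connectivity K always
-- contains a neighbour of x₁ or x₂ that can play this role. The witnesses of x₁ and x₂ need a
-- colour occurring exactly once in their whole neighbourhood, so one clique gets a special
-- colouring while the other cliques use that colour only on vertices without neighbours in X.
-- Which special clique exists depends on whether x₁x₂ is an edge and on how the cliques meet
-- N(x₁) and N(x₂); four colourings of this kind cover all cases, up to exchanging x₁ and x₂.
module Submission where

open import Defs hiding (sym)
open import Data.Nat using (ℕ; _≤_)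
import Data.Nat as ℕ
open import Data.Fin using (Fin; zero; suc)
open import Data.Fin.Patterns using (0F; 1F; 2F)
open import Data.Fin.Properties using (_≟_; suc-injective; any?; all?; ¬∀⟶∃¬)
open import Data.Bool using (Bool; true; false; _∧_; T; T?; if_then_else_)
import Data.Bool.Properties as Bool
open import Data.List using (length; filter; tabulate)
open import Data.List.Properties using (filter-none)
open import Data.List.Relation.Unary.All.Properties using (tabulate⁺)
open import Data.Product using (∃; ∃-syntax; _×_; _,_; proj₁; proj₂; swap; map₁)
open import Data.Sum using (_⊎_; inj₁; inj₂)
open import Function using (_∘_; Equivalence)
open import Relation.Binary.PropositionalEquality
  using (_≡_; _≢_; refl; sym; trans; cong; subst)
open import Relation.Nullary using (¬_; Dec; yes; no; does; contradiction)
open import Relation.Nullary.Decidable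
  using (_×-dec_; _→-dec_; ¬?; decidable-stable; dec-true; dec-false)

length-filter-tabulate≡1 : ∀ {A : Set} {m} (b : A → Bool) (g : Fin m → A) (u : Fin m) →
  b (g u) ≡ true → (∀ w → b (g w) ≡ true → w ≡ u) →
  length (filter (λ x → T? (b x)) (tabulate g)) ≡ 1
length-filter-tabulate≡1 b g zero bgu unique rewrite bgu =
  cong (ℕ.suc ∘ length) (filter-none (λ x → T? (b x)) (tabulate⁺ rejected))
  where
  rejected : ∀ w → ¬ T (b (g (suc w)))
  rejected w t = contradiction (unique (suc w) (Equivalence.to Bool.T-≡ t)) λ ()
length-filter-tabulate≡1 b g (suc u) bgu unique with b (g zero) in bg₀
... | true  = contradiction (unique zero bg₀) λ ()
... | false =
  length-filter-tabulate≡1 b (g ∘ suc) u bgu (λ w → suc-injective ∘ unique (suc w))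

count≡1 : ∀ {n} (p : Fin n → Bool) (u : Fin n) →
  p u ≡ true → (∀ w → p w ≡ true → w ≡ u) → count p ≡ 1
count≡1 p = length-filter-tabulate≡1 p (λ x → x)

nbrCount≡1 : ∀ {n k} (G : Graph n) (C : Fin n → Fin k) (v : Fin n) (i : Fin k) (u : Fin n) →
  Adj G v u → C u ≡ i → (∀ w → Adj G v w → C w ≡ i → w ≡ u) →
  nbrCount G C v i ≡ 1
nbrCount≡1 G C v i u vu Cu unique = count≡1 _ u selected only
  where
  selected : adj G v u ∧ does (C u ≟ i) ≡ true
  selected rewrite vu | dec-true (C u ≟ i) Cu = refl
  chosen : ∀ w → adj G v w ∧ does (C w ≟ i) ≡ true → Adj G v w × C w ≡ i
  chosen w e with adj G v w | C w ≟ i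
  ... | true  | yes Cw = refl , Cw
  ... | true  | no _   = contradiction e λ ()
  ... | false | _      = contradiction e λ ()
  only : ∀ w → adj G v w ∧ does (C w ≟ i) ≡ true → w ≡ u
  only w e = let vw , Cw = chosen w e in unique w vw Cw

Witness : ∀ {n k} → Graph n → (Fin n → Fin k) → Fin n → Set
Witness G C v = ∃[ i ] nbrCount G C v i ≡ 1

module _ {n : ℕ} (G : Graph n) where

  Adj? : ∀ u v → Dec (Adj G u v)
  Adj? u v = adj G u v Bool.≟ true

  Adj-sym : ∀ {u v} → Adj G u v → Adj G v u
  Adj-sym {u} {v} = trans (Graph.sym G v u)

  Adj-irrefl : ∀ {u} → ¬ Adj G u u
  Adj-irrefl {u} uu = contradiction (trans (sym uu) (loopless G u)) λ ()

module _ {n : ℕ} {B : Set} where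

  highlight : Fin n → B → B → Fin n → B
  highlight a s d u = if does (u ≟ a) then s else d

  highlight₂ : Fin n → B → Fin n → B → B → Fin n → B
  highlight₂ a s b t d u = if does (u ≟ a) then s else highlight b t d u

  highlight-at : ∀ a {s d : B} → highlight a s d a ≡ s
  highlight-at a rewrite dec-true (a ≟ a) refl = refl

  highlight-unique : ∀ {a} {s d : B} {u} → s ≢ d → highlight a s d u ≡ s → u ≡ a
  highlight-unique {a} {u = u} s≢d e with u ≟ a
  ... | yes u≡a = u≡a
  ... | no _    = contradiction (sym e) s≢d

  highlight-avoids : ∀ {a} {s d i : B} u → s ≢ i → d ≢ i → highlight a s d u ≢ i
  highlight-avoids {a} u s≢i d≢i with u ≟ a
  ... | yes _ = s≢i
  ... | no _  = d≢i

  highlight₂-first : ∀ a {s t d : B} {b} → highlight₂ a s b t d a ≡ s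
  highlight₂-first a rewrite dec-true (a ≟ a) refl = refl

  highlight₂-second : ∀ {a} {s t d : B} b → b ≢ a → highlight₂ a s b t d b ≡ t
  highlight₂-second b b≢a rewrite dec-false (b ≟ _) b≢a = highlight-at b

  highlight₂-unique₁ : ∀ {a b} {s t d : B} {u} →
    s ≢ t → s ≢ d → highlight₂ a s b t d u ≡ s → u ≡ a
  highlight₂-unique₁ {a} {u = u} s≢t s≢d e with u ≟ a
  ... | yes u≡a = u≡a
  ... | no _    = contradiction (sym e) (highlight-avoids u (s≢t ∘ sym) (s≢d ∘ sym) ∘ sym)

  highlight₂-unique₂ : ∀ {a b} {s t d : B} {u} →
    t ≢ s → t ≢ d → highlight₂ a s b t d u ≡ t → u ≡ b
  highlight₂-unique₂ {a} {u = u} t≢s t≢d e with u ≟ a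
  ... | yes _ = contradiction (sym e) t≢s
  ... | no _  = highlight-unique t≢d e

swapCliques : ∀ {n} {G : Graph n} {x₁ x₂} →
  DisjointUnionOfCliquesOutside G x₁ x₂ → DisjointUnionOfCliquesOutside G x₂ x₁
swapCliques D = proj₁ D , λ u v u₂ u₁ v₂ v₁ → proj₂ D u v u₁ u₂ v₁ v₂

module Cluster {n : ℕ} (G : Graph n) (connected : Connected G)
               (x₁ x₂ : Fin n) (x₁≢x₂ : x₁ ≢ x₂)
               (cliques : DisjointUnionOfCliquesOutside G x₁ x₂) where

  cl : Fin n → ℕ
  cl = proj₁ cliques

  Inner N₁ N₂ Detached : Fin n → Set
  Inner u = u ≢ x₁ × u ≢ x₂
  N₁ u = Adj G u x₁
  N₂ u = Adj G u x₂
  Detached u = ¬ N₁ u × ¬ N₂ u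

  Member : ℕ → Fin n → Set
  Member c u = Inner u × cl u ≡ c

  Mate : Fin n → Fin n → Set
  Mate v u = Member (cl v) u × u ≢ v

  Inner? : ∀ u → Dec (Inner u)
  Inner? u = ¬? (u ≟ x₁) ×-dec ¬? (u ≟ x₂)

  Member? : ∀ c u → Dec (Member c u)
  Member? c u = Inner? u ×-dec (cl u ℕ.≟ c)

  N₁? : ∀ u → Dec (N₁ u)
  N₁? u = Adj? G u x₁

  N₂? : ∀ u → Dec (N₂ u)
  N₂? u = Adj? G u x₂

  Detached? : ∀ u → Dec (Detached u)
  Detached? u = ¬? (N₁? u) ×-dec ¬? (N₂? u)

  members⇒mate : ∀ {c u v} → Member c v → Member c u → u ≢ v → Mate v u
  members⇒mate (_ , cv) (iu , cu) u≢v = (iu , trans cu (sym cv)) , u≢v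

  mate⇒adj : ∀ {u v} → Inner v → Mate v u → Adj G v u
  mate⇒adj {u} {v} (v₁ , v₂) (((u₁ , u₂) , cu) , u≢v) =
    Equivalence.from (proj₂ cliques v u v₁ v₂ u₁ u₂ (u≢v ∘ sym)) (sym cu)

  adj⇒mate : ∀ {u v} → Inner v → Inner u → Adj G v u → Mate v u
  adj⇒mate {u} {v} (v₁ , v₂) iu@(u₁ , u₂) vu =
    (iu , sym (Equivalence.to (proj₂ cliques v u v₁ v₂ u₁ u₂ (u≢v ∘ sym)) vu)) , u≢v
    where
    u≢v : u ≢ v
    u≢v refl = Adj-irrefl G vu

  adj⇒sameClique : ∀ {u v} → Inner v → Inner u → Adj G v u → cl u ≡ cl v
  adj⇒sameClique iv iu vu = proj₂ (proj₁ (adj⇒mate iv iu vu))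

  ≢detached : ∀ {b z} → N₁ b ⊎ N₂ b → Detached z → b ≢ z
  ≢detached (inj₁ b₁) (¬z₁ , _) refl = ¬z₁ b₁
  ≢detached (inj₂ b₂) (_ , ¬z₂) refl = ¬z₂ b₂

  ¬all⇒counterexample : ∀ {c} {P : Fin n → Set} → (∀ u → Dec (P u)) →
    ¬ (∀ u → Member c u → P u) → ∃ λ u → Member c u × ¬ P u
  ¬all⇒counterexample {c} P? ¬all =
    let u , ¬imp = ¬∀⟶∃¬ n _ (λ u → Member? c u →-dec P? u) ¬all
    in u , decidable-stable (Member? c u) (λ ¬mu → ¬imp λ mu → contradiction mu ¬mu)
         , λ pu → ¬imp λ _ → pu

  data Place (u : Fin n) : Set where
    at-x₁ : u ≡ x₁ → Place u
    at-x₂ : u ≡ x₂ → Place u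
    inner : Inner u → Place u

  place : ∀ u → Place u
  place u with u ≟ x₁ | u ≟ x₂
  ... | yes u≡x₁ | _        = at-x₁ u≡x₁
  ... | no _     | yes u≡x₂ = at-x₂ u≡x₂
  ... | no u≢x₁  | no u≢x₂  = inner (u≢x₁ , u≢x₂)

  meetsX : ∀ {c v} → Member c v → ∃ λ u → Member c u × (N₁ u ⊎ N₂ u)
  meetsX (iv , refl) = go (connected _ x₁) refl iv
    where
    go : ∀ {s t} → Walk G s t → t ≡ x₁ → Inner s →
      ∃ λ u → Member (cl s) u × (N₁ u ⊎ N₂ u)
    go here refl (s≢x₁ , _) = contradiction refl s≢x₁
    go {s} (step {w = w} sw walk) t≡x₁ is with place w
    ... | at-x₁ refl = s , (is , refl) , inj₁ sw
    ... | at-x₂ refl = s , (is , refl) , inj₂ sw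
    ... | inner iw with go walk t≡x₁ iw
    ...   | u , (iu , cu) , touches = u , (iu , trans cu (adj⇒sameClique is iw sw)) , touches

  data LocalWitness (p q : Fin 3) (h : Fin n → Fin 3) (v : Fin n) : Set where
    viaMate : ∀ {i} u → Mate v u → h u ≡ i → (∀ w → h w ≡ i → w ≡ u) →
              (N₁ v → p ≢ i) → (N₂ v → q ≢ i) → LocalWitness p q h v
    viaX₁   : N₁ v → (N₂ v → q ≢ p) → (∀ u → Mate v u → h u ≢ p) → LocalWitness p q h v
    viaX₂   : N₂ v → (N₁ v → p ≢ q) → (∀ u → Mate v u → h u ≢ q) → LocalWitness p q h v

  LocallyConflictFree : Fin 3 → Fin 3 → ℕ → (Fin n → Fin 3) → Set
  LocallyConflictFree p q c h = ∀ v → Member c v → LocalWitness p q h v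

  local⇒witness : ∀ {p q h v} (C : Fin n → Fin 3) → C x₁ ≡ p → C x₂ ≡ q → Inner v →
    (∀ u → Mate v u → C u ≡ h u) → LocalWitness p q h v → Witness G C v
  local⇒witness {v = v} C Cx₁ Cx₂ iv C≗h (viaMate {i} u m hu unique p≢i q≢i) =
    i , nbrCount≡1 G C v i u (mate⇒adj iv m) (trans (C≗h u m) hu) only
    where
    only : ∀ w → Adj G v w → C w ≡ i → w ≡ u
    only w vw Cw with place w
    ... | at-x₁ refl = contradiction (trans (sym Cx₁) Cw) (p≢i vw)
    ... | at-x₂ refl = contradiction (trans (sym Cx₂) Cw) (q≢i vw)
    ... | inner iw   = unique w (trans (sym (C≗h w (adj⇒mate iv iw vw))) Cw)
  local⇒witness {p} {v = v} C Cx₁ Cx₂ iv C≗h (viaX₁ v₁ q≢p avoids) =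
    p , nbrCount≡1 G C v p x₁ v₁ Cx₁ only
    where
    only : ∀ w → Adj G v w → C w ≡ p → w ≡ x₁
    only w vw Cw with place w
    ... | at-x₁ w≡x₁ = w≡x₁
    ... | at-x₂ refl = contradiction (trans (sym Cx₂) Cw) (q≢p vw)
    ... | inner iw   = let m = adj⇒mate iv iw vw in
                       contradiction (trans (sym (C≗h w m)) Cw) (avoids w m)
  local⇒witness {q = q} {v = v} C Cx₁ Cx₂ iv C≗h (viaX₂ v₂ p≢q avoids) =
    q , nbrCount≡1 G C v q x₂ v₂ Cx₂ only
    where
    only : ∀ w → Adj G v w → C w ≡ q → w ≡ x₂
    only w vw Cw with place w
    ... | at-x₁ refl = contradiction (trans (sym Cx₁) Cw) (p≢q vw)
    ... | at-x₂ w≡x₂ = w≡x₂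
    ... | inner iw   = let m = adj⇒mate iv iw vw in
                       contradiction (trans (sym (C≗h w m)) Cw) (avoids w m)

  highlight-witness : ∀ {p q c a s d v} → Member c a → Member c v → v ≢ a → s ≢ d →
    (N₁ v → p ≢ s) → (N₂ v → q ≢ s) → LocalWitness p q (highlight a s d) v
  highlight-witness {a = a} ma mv v≢a s≢d =
    viaMate a (members⇒mate mv ma (v≢a ∘ sym)) (highlight-at a) (λ _ → highlight-unique s≢d)

  highlight₂-witness₁ : ∀ {p q c a b s t d v} → Member c a → Member c v → v ≢ a →
    s ≢ t → s ≢ d → (N₁ v → p ≢ s) → (N₂ v → q ≢ s) →
    LocalWitness p q (highlight₂ a s b t d) v
  highlight₂-witness₁ {a = a} ma mv v≢a s≢t s≢d =
    viaMate a (members⇒mate mv ma (v≢a ∘ sym)) (highlight₂-first a)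
      (λ _ → highlight₂-unique₁ s≢t s≢d)

  highlight₂-witness₂ : ∀ {p q c a b s t d v} → Member c b → Member c v → v ≢ b → b ≢ a →
    t ≢ s → t ≢ d → (N₁ v → p ≢ t) → (N₂ v → q ≢ t) →
    LocalWitness p q (highlight₂ a s b t d) v
  highlight₂-witness₂ {b = b} mb mv v≢b b≢a t≢s t≢d =
    viaMate b (members⇒mate mv mb (v≢b ∘ sym)) (highlight₂-second b b≢a)
      (λ _ → highlight₂-unique₂ t≢s t≢d)

  colouring : Fin 3 → Fin 3 → (ℕ → Fin n → Fin 3) → Fin n → Fin 3
  colouring p q F u with place u
  ... | at-x₁ _ = p
  ... | at-x₂ _ = q
  ... | inner _ = F (cl u) u

  module _ (p q : Fin 3) (F : ℕ → Fin n → Fin 3) where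

    colouring-x₁ : colouring p q F x₁ ≡ p
    colouring-x₁ with place x₁
    ... | at-x₁ _           = refl
    ... | at-x₂ x₁≡x₂       = contradiction x₁≡x₂ x₁≢x₂
    ... | inner (x₁≢x₁ , _) = contradiction refl x₁≢x₁

    colouring-x₂ : colouring p q F x₂ ≡ q
    colouring-x₂ with place x₂
    ... | at-x₁ x₂≡x₁       = contradiction (sym x₂≡x₁) x₁≢x₂
    ... | at-x₂ _           = refl
    ... | inner (_ , x₂≢x₂) = contradiction refl x₂≢x₂

    colouring-inner : ∀ {u} → Inner u → colouring p q F u ≡ F (cl u) u
    colouring-inner {u} (u≢x₁ , u≢x₂) with place u
    ... | at-x₁ u≡x₁ = contradiction u≡x₁ u≢x₁
    ... | at-x₂ u≡x₂ = contradiction u≡x₂ u≢x₂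
    ... | inner _    = refl

    colouring-inner-witness : (∀ c → LocallyConflictFree p q c (F c)) →
      ∀ {v} → Inner v → Witness G (colouring p q F) v
    colouring-inner-witness lcf {v} iv =
      local⇒witness _ colouring-x₁ colouring-x₂ iv agree (lcf (cl v) v (iv , refl))
      where
      agree : ∀ u → Mate v u → colouring p q F u ≡ F (cl v) u
      agree u ((iu , cu) , _) = trans (colouring-inner iu) (cong (λ c → F c u) cu)

  x₁-witness : ∀ (C : Fin n → Fin 3) {i} u → Adj G x₁ u → C u ≡ i →
    (Adj G x₁ x₂ → C x₂ ≡ i → x₂ ≡ u) →
    (∀ w → Inner w → N₁ w → C w ≡ i → w ≡ u) → Witness G C x₁
  x₁-witness C {i} u x₁u Cu atX₂ atInner = i , nbrCount≡1 G C x₁ i u x₁u Cu only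
    where
    only : ∀ w → Adj G x₁ w → C w ≡ i → w ≡ u
    only w x₁w Cw with place w
    ... | at-x₁ refl = contradiction x₁w (Adj-irrefl G)
    ... | at-x₂ refl = atX₂ x₁w Cw
    ... | inner iw   = atInner w iw (Adj-sym G x₁w) Cw

  x₂-witness : ∀ (C : Fin n → Fin 3) {i} u → Adj G x₂ u → C u ≡ i →
    (Adj G x₂ x₁ → C x₁ ≡ i → x₁ ≡ u) →
    (∀ w → Inner w → N₂ w → C w ≡ i → w ≡ u) → Witness G C x₂
  x₂-witness C {i} u x₂u Cu atX₁ atInner = i , nbrCount≡1 G C x₂ i u x₂u Cu only
    where
    only : ∀ w → Adj G x₂ w → C w ≡ i → w ≡ u
    only w x₂w Cw with place w
    ... | at-x₁ refl = atX₁ x₂w Cw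
    ... | at-x₂ refl = contradiction x₂w (Adj-irrefl G)
    ... | inner iw   = atInner w iw (Adj-sym G x₂w) Cw

  cfon : (C : Fin n → Fin 3) → Witness G C x₁ → Witness G C x₂ →
    (∀ {v} → Inner v → Witness G C v) → χON≤ G 3
  cfon C w₁ w₂ wᵢ = C , witness
    where
    witness : IsCFON G C
    witness v with place v
    ... | at-x₁ refl = w₁
    ... | at-x₂ refl = w₂
    ... | inner iv   = wᵢ iv

  overlay : ℕ → (Fin n → Fin 3) → (ℕ → Fin n → Fin 3) → ℕ → Fin n → Fin 3
  overlay c₀ W D c with c ℕ.≟ c₀
  ... | yes _ = W
  ... | no _  = D c

  overlay-here : ∀ c₀ W D u → overlay c₀ W D c₀ u ≡ W u
  overlay-here c₀ W D u with c₀ ℕ.≟ c₀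
  ... | yes _    = refl
  ... | no c₀≢c₀ = contradiction refl c₀≢c₀

  overlay-lcf : ∀ {p q c₀ W D} → LocallyConflictFree p q c₀ W →
    (∀ c → LocallyConflictFree p q c (D c)) → ∀ c → LocallyConflictFree p q c (overlay c₀ W D c)
  overlay-lcf {c₀ = c₀} W-lcf D-lcf c with c ℕ.≟ c₀
  ... | yes refl = W-lcf
  ... | no _     = D-lcf c

  overlay-fibre : ∀ {p q c₀ W D} (P : Fin n → Set) {i} →
    (∀ u → Member c₀ u → W u ≡ i → P u) → (∀ c u → Member c u → D c u ≡ i → P u) →
    ∀ u → Inner u → colouring p q (overlay c₀ W D) u ≡ i → P u
  overlay-fibre {p} {q} {c₀} {W} {D} P W-fibre D-fibre u iu Cu
    with cl u ℕ.≟ c₀ | colouring-inner p q (overlay c₀ W D) iu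
  ... | yes cu | Cu≡ = W-fibre u (iu , cu) (trans (sym Cu≡) Cu)
  ... | no _   | Cu≡ = D-fibre (cl u) u (iu , refl) (trans (sym Cu≡) Cu)

  SoleColoured : (Fin n → Fin 3) → Fin 3 → Fin n → Set
  SoleColoured C k y = ∀ u → Inner u → C u ≡ k → u ≡ y ⊎ Detached u

  sole₁ : ∀ {C k y} → SoleColoured C k y → ∀ w → Inner w → N₁ w → C w ≡ k → w ≡ y
  sole₁ sole w iw w₁ Cw with sole w iw Cw
  ... | inj₁ w≡y       = w≡y
  ... | inj₂ (¬w₁ , _) = contradiction w₁ ¬w₁

  sole₂ : ∀ {C k y} → SoleColoured C k y → ∀ w → Inner w → N₂ w → C w ≡ k → w ≡ y
  sole₂ sole w iw w₂ Cw with sole w iw Cw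
  ... | inj₁ w≡y       = w≡y
  ... | inj₂ (_ , ¬w₂) = contradiction w₂ ¬w₂

  CommonNeighbour : Set
  CommonNeighbour = ∃ λ y → Inner y × N₁ y × N₂ y

  commonNeighbour? : Dec CommonNeighbour
  commonNeighbour? = any? λ y → Inner? y ×-dec N₁? y ×-dec N₂? y

  Closed₁ Closed₂ : Set
  Closed₁ = ∀ c a r → Member c a → N₁ a → ¬ N₂ a → Member c r → N₁ r
  Closed₂ = ∀ c a r → Member c a → N₂ a → ¬ N₁ a → Member c r → N₂ r

  Escapes : Fin n → Set
  Escapes y = ∃ λ r → Member (cl y) r × ¬ N₁ r

  escapes? : ∀ y → Dec (Escapes y)
  escapes? y = any? λ r → Member? (cl y) r ×-dec ¬? (N₁? r)

  Loose : Set
  Loose = ∃ λ y → Inner y × N₁ y × ¬ N₂ y × Escapes y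

  loose? : Dec Loose
  loose? = any? λ y → Inner? y ×-dec N₁? y ×-dec ¬? (N₂? y) ×-dec escapes? y

  ¬loose⇒closed : ¬ Loose → Closed₁
  ¬loose⇒closed ¬loose c a r (ia , ca) a₁ ¬a₂ (ir , cr) = decidable-stable (N₁? r) λ ¬r₁ →
    ¬loose (a , ia , a₁ , ¬a₂ , r , (ir , trans cr (sym ca)) , ¬r₁)

  -- x₁ ↦ 0 and x₂ ↦ 1. Outside the clique of y colour 0 is used only on vertices with no
  -- neighbour in X, so y is the unique neighbour of x₁ coloured 0, and x₂ sees 0 exactly once
  -- at x₁ or at y.

  data ZeroShape (c : ℕ) : Set where
    meets₁  : ∀ r → Member c r → N₁ r → ZeroShape c
    meets₂  : ∀ r w → Member c r → N₂ r → ¬ N₁ r → Member c w → Detached w → ZeroShape c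
    inside₂ : (∀ u → Member c u → N₂ u × ¬ N₁ u) → ZeroShape c

  zeroShape : ∀ c → ZeroShape c
  zeroShape c
    with any? (λ r → Member? c r ×-dec N₁? r) | any? (λ w → Member? c w ×-dec Detached? w)
  ... | yes (r , mr , r₁) | _ = meets₁ r mr r₁
  ... | no ¬meets₁ | no ¬detached = inside₂ λ u mu →
    let ¬u₁ = λ u₁ → ¬meets₁ (u , mu , u₁)
    in decidable-stable (N₂? u) (λ ¬u₂ → ¬detached (u , mu , ¬u₁ , ¬u₂)) , ¬u₁
  ... | no ¬meets₁ | yes (w , mw , dw) with meetsX mw
  ...   | r , mr , inj₁ r₁ = contradiction (r , mr , r₁) ¬meets₁
  ...   | r , mr , inj₂ r₂ = meets₂ r w mr r₂ (λ r₁ → ¬meets₁ (r , mr , r₁)) mw dw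

  paintZero : ∀ {c} → ZeroShape c → Fin n → Fin 3
  paintZero (meets₁ r _ _)         = highlight r 2F 1F
  paintZero (meets₂ r w _ _ _ _ _) = highlight₂ r 2F w 0F 1F
  paintZero (inside₂ _)            = λ _ → 2F

  paintZero-lcf : ∀ {c} (σ : ZeroShape c) → LocallyConflictFree 0F 1F c (paintZero σ)
  paintZero-lcf (meets₁ r mr r₁) v mv with v ≟ r
  ... | yes refl = viaX₁ r₁ (λ _ ()) (λ u _ → highlight-avoids u (λ ()) (λ ()))
  ... | no v≢r   = highlight-witness mr mv v≢r (λ ()) (λ _ ()) (λ _ ())
  paintZero-lcf (meets₂ r w mr r₂ ¬r₁ mw dw) v mv with v ≟ r
  ... | yes refl =
    highlight₂-witness₂ mw mv r≢w (r≢w ∘ sym) (λ ()) (λ ()) (λ r₁ _ → ¬r₁ r₁) (λ _ ())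
    where
    r≢w : r ≢ w
    r≢w = ≢detached (inj₂ r₂) dw
  ... | no v≢r   = highlight₂-witness₁ mr mv v≢r (λ ()) (λ ()) (λ _ ()) (λ _ ())
  paintZero-lcf (inside₂ all₂) v mv =
    let v₂ , ¬v₁ = all₂ v mv in viaX₂ v₂ (λ v₁ _ → ¬v₁ v₁) (λ _ _ ())

  paintZero-zero : ∀ {c} (σ : ZeroShape c) u → paintZero σ u ≡ 0F → Detached u
  paintZero-zero (meets₁ _ _ _) u e = contradiction e (highlight-avoids u (λ ()) (λ ()))
  paintZero-zero (meets₂ r w _ _ _ _ dw) u e =
    subst Detached (sym (highlight₂-unique₂ {a = r} {b = w} (λ ()) (λ ()) e)) dw
  paintZero-zero (inside₂ _) u ()

  soleZeroAt : ∀ y (W : Fin n → Fin 3) → Inner y → N₁ y →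
    LocallyConflictFree 0F 1F (cl y) W → W y ≡ 0F → (∀ u → W u ≡ 0F → u ≡ y) →
    (Adj G x₁ x₂ × ¬ N₂ y) ⊎ (¬ Adj G x₁ x₂ × N₂ y) → χON≤ G 3
  soleZeroAt y W iy y₁ W-lcf Wy W-unique x₂-case =
    cfon C (x₁-witness C y (Adj-sym G y₁) Cy x₂-nonzero (sole₁ zeroes)) (x₂-ok x₂-case)
      (colouring-inner-witness 0F 1F F (overlay-lcf W-lcf λ c → paintZero-lcf (zeroShape c)))
    where
    D F : ℕ → Fin n → Fin 3
    D c = paintZero (zeroShape c)
    F = overlay (cl y) W D
    C : Fin n → Fin 3
    C = colouring 0F 1F F
    Cy : C y ≡ 0F
    Cy = trans (colouring-inner 0F 1F F iy) (trans (overlay-here (cl y) W D y) Wy)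
    x₂-nonzero : Adj G x₁ x₂ → C x₂ ≡ 0F → x₂ ≡ y
    x₂-nonzero _ C₂ = contradiction (trans (sym (colouring-x₂ 0F 1F F)) C₂) λ ()
    zeroes : SoleColoured C 0F y
    zeroes = overlay-fibre _ (λ u _ Wu → inj₁ (W-unique u Wu))
                             (λ c u _ Du → inj₂ (paintZero-zero (zeroShape c) u Du))
    x₂-ok : (Adj G x₁ x₂ × ¬ N₂ y) ⊎ (¬ Adj G x₁ x₂ × N₂ y) → Witness G C x₂
    x₂-ok (inj₁ (x₁x₂ , ¬y₂)) =
      x₂-witness C x₁ (Adj-sym G x₁x₂) (colouring-x₁ 0F 1F F) (λ _ _ → refl)
        λ w iw w₂ Cw → contradiction (subst N₂ (sole₂ zeroes w iw w₂ Cw) w₂) ¬y₂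
    x₂-ok (inj₂ (x₁≁x₂ , y₂)) =
      x₂-witness C y (Adj-sym G y₂) Cy (λ x₂x₁ _ → contradiction (Adj-sym G x₂x₁) x₁≁x₂)
        (sole₂ zeroes)

  escaping : ∀ y r → Inner y → N₁ y → Member (cl y) r → ¬ N₁ r →
    (Adj G x₁ x₂ × ¬ N₂ y) ⊎ (¬ Adj G x₁ x₂ × N₂ y) → χON≤ G 3
  escaping y r iy y₁ mr ¬r₁ =
    soleZeroAt y (highlight₂ y 0F r 2F 1F) iy y₁ lcf (highlight₂-first y)
      (λ _ → highlight₂-unique₁ (λ ()) (λ ()))
    where
    r≢y : r ≢ y
    r≢y refl = ¬r₁ y₁
    lcf : LocallyConflictFree 0F 1F (cl y) (highlight₂ y 0F r 2F 1F)
    lcf v mv with v ≟ r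
    ... | yes refl =
      highlight₂-witness₁ (iy , refl) mv r≢y (λ ()) (λ ()) (λ r₁ _ → ¬r₁ r₁) (λ _ ())
    ... | no v≢r   = highlight₂-witness₂ mr mv v≢r r≢y (λ ()) (λ ()) (λ _ ()) (λ _ ())

  insideBoth : ¬ Adj G x₁ x₂ → ∀ y → Inner y → N₁ y → (∀ u → Member (cl y) u → N₂ u) →
    χON≤ G 3
  insideBoth x₁≁x₂ y iy y₁ all₂ =
    soleZeroAt y (highlight y 0F 2F) iy y₁ lcf (highlight-at y) (λ _ → highlight-unique (λ ()))
      (inj₂ (x₁≁x₂ , all₂ y (iy , refl)))
    where
    lcf : LocallyConflictFree 0F 1F (cl y) (highlight y 0F 2F)
    lcf v mv with v ≟ y
    ... | yes refl = viaX₁ y₁ (λ _ ()) (λ u (_ , u≢y) → u≢y ∘ highlight-unique (λ ()))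
    ... | no _     = viaX₂ (all₂ v mv) (λ _ ()) (λ u _ → highlight-avoids u (λ ()) (λ ()))

  -- x₁ ↦ 0 and x₂ ↦ 1. Colour 2 lies on an X-neighbour only at y, which therefore witnesses
  -- both x₁ and x₂.

  data SharedShape (c : ℕ) : Set where
    detached : ∀ z b → Member c z → Detached z → Member c b → b ≢ z → SharedShape c
    within₁  : (∀ u → Member c u → N₁ u) → SharedShape c
    within₂  : (∀ u → Member c u → N₂ u) → SharedShape c

  sharedShape : Closed₁ → ∀ c → SharedShape c
  sharedShape closed₁ c
    with any? (λ z → Member? c z ×-dec Detached? z) | any? (λ a → Member? c a ×-dec ¬? (N₁? a))
  ... | no ¬detached | yes (a , ma , ¬a₁) = within₂ λ u mu → decidable-stable (N₂? u) λ ¬u₂ →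
    let u₁ = decidable-stable (N₁? u) λ ¬u₁ → ¬detached (u , mu , ¬u₁ , ¬u₂)
    in ¬a₁ (closed₁ c u a mu u₁ ¬u₂ ma)
  ... | no _ | no ¬outside₁ =
    within₁ λ u mu → decidable-stable (N₁? u) λ ¬u₁ → ¬outside₁ (u , mu , ¬u₁)
  ... | yes (z , mz , dz) | _ with meetsX mz
  ...   | b , mb , touches = detached z b mz dz mb (≢detached touches dz)

  paintShared : ∀ {c} → SharedShape c → Fin n → Fin 3
  paintShared (detached z b _ _ _ _) = highlight₂ b 1F z 2F 0F
  paintShared (within₁ _)            = λ _ → 1F
  paintShared (within₂ _)            = λ _ → 0F

  paintShared-lcf : ∀ {c} (σ : SharedShape c) → LocallyConflictFree 0F 1F c (paintShared σ)
  paintShared-lcf (detached z b mz (¬z₁ , ¬z₂) mb b≢z) v mv with v ≟ z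
  ... | yes refl =
    highlight₂-witness₁ mb mv (b≢z ∘ sym) (λ ()) (λ ()) (λ z₁ _ → ¬z₁ z₁) (λ z₂ _ → ¬z₂ z₂)
  ... | no v≢z   = highlight₂-witness₂ mz mv v≢z (b≢z ∘ sym) (λ ()) (λ ()) (λ _ ()) (λ _ ())
  paintShared-lcf (within₁ all₁) v mv = viaX₁ (all₁ v mv) (λ _ ()) (λ _ _ ())
  paintShared-lcf (within₂ all₂) v mv = viaX₂ (all₂ v mv) (λ _ ()) (λ _ _ ())

  paintShared-two : ∀ {c} (σ : SharedShape c) u → paintShared σ u ≡ 2F → Detached u
  paintShared-two (detached z b _ dz _ _) u e =
    subst Detached (sym (highlight₂-unique₂ {a = b} {b = z} (λ ()) (λ ()) e)) dz
  paintShared-two (within₁ _) u ()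
  paintShared-two (within₂ _) u ()

  sharedNeighbour : Closed₁ → CommonNeighbour → χON≤ G 3
  sharedNeighbour closed₁ (y , iy , y₁ , y₂) =
    cfon C (x₁-witness C y (Adj-sym G y₁) Cy
              (λ _ C₂ → contradiction (trans (sym (colouring-x₂ 0F 1F F)) C₂) λ ()) (sole₁ twos))
           (x₂-witness C y (Adj-sym G y₂) Cy
              (λ _ C₁ → contradiction (trans (sym (colouring-x₁ 0F 1F F)) C₁) λ ()) (sole₂ twos))
           (colouring-inner-witness 0F 1F F (overlay-lcf W-lcf D-lcf))
    where
    W : Fin n → Fin 3
    W = highlight y 2F 0F
    D F : ℕ → Fin n → Fin 3
    D c = paintShared (sharedShape closed₁ c)
    F = overlay (cl y) W D
    D-lcf : ∀ c → LocallyConflictFree 0F 1F c (D c)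
    D-lcf c = paintShared-lcf (sharedShape closed₁ c)
    C : Fin n → Fin 3
    C = colouring 0F 1F F
    Cy : C y ≡ 2F
    Cy = trans (colouring-inner 0F 1F F iy) (trans (overlay-here (cl y) W D y) (highlight-at y))
    W-lcf : LocallyConflictFree 0F 1F (cl y) W
    W-lcf v mv with v ≟ y
    ... | yes refl = viaX₂ y₂ (λ _ ()) (λ u _ → highlight-avoids u (λ ()) (λ ()))
    ... | no v≢y   = highlight-witness (iy , refl) mv v≢y (λ ()) (λ _ ()) (λ _ ())
    twos : SoleColoured C 2F y
    twos = overlay-fibre _ (λ u _ Wu → inj₁ (highlight-unique (λ ()) Wu))
                           (λ c u _ Du → inj₂ (paintShared-two (sharedShape closed₁ c) u Du))

  -- Every vertex outside X has exactly one neighbour in X, and x₁, x₂ witness each other.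
  separated : Adj G x₁ x₂ → ¬ CommonNeighbour → Closed₁ → Closed₂ → χON≤ G 3
  separated x₁x₂ ¬common closed₁ closed₂ =
    cfon C (x₁-witness C x₂ x₁x₂ (colouring-x₂ 0F 1F F) (λ _ _ → refl)
              λ w iw _ Cw → contradiction (inner-two w iw Cw) λ ())
           (x₂-witness C x₁ (Adj-sym G x₁x₂) (colouring-x₁ 0F 1F F) (λ _ _ → refl)
              λ w iw _ Cw → contradiction (inner-two w iw Cw) λ ())
           (colouring-inner-witness 0F 1F F lcf)
    where
    F : ℕ → Fin n → Fin 3
    F _ _ = 2F
    C : Fin n → Fin 3
    C = colouring 0F 1F F
    inner-two : ∀ {i} w → Inner w → C w ≡ i → i ≡ 2F
    inner-two w iw Cw = trans (sym Cw) (colouring-inner 0F 1F F iw)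
    lcf : ∀ c → LocallyConflictFree 0F 1F c (F c)
    lcf c v mv with meetsX mv
    ... | u , mu , inj₁ u₁ = viaX₁ v₁ (λ _ ()) (λ _ _ ())
      where
      v₁ : N₁ v
      v₁ = closed₁ c u v mu u₁ (λ u₂ → ¬common (u , proj₁ mu , u₁ , u₂)) mv
    ... | u , mu , inj₂ u₂ = viaX₂ v₂ (λ _ ()) (λ _ _ ())
      where
      v₂ : N₂ v
      v₂ = closed₂ c u v mu u₂ (λ u₁ → ¬common (u , proj₁ mu , u₁ , u₂)) mv

  Bridge : Set
  Bridge = ∃ λ α → ∃ λ β → Inner α × Member (cl α) β × N₁ α × N₂ β

  bridge : ¬ Adj G x₁ x₂ → Bridge
  bridge x₁≁x₂ =
    decidable-stable bridge? λ ¬bridge → proj₁ (unbridged ¬bridge (connected x₁ x₂)) refl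
    where
    bridge? : Dec Bridge
    bridge? = any? λ α → any? λ β → Inner? α ×-dec Member? (cl α) β ×-dec N₁? α ×-dec N₂? β
    unbridged : ¬ Bridge → ∀ {s} → Walk G s x₂ →
      s ≢ x₁ × (Inner s → ∃ λ u → Member (cl s) u × N₂ u)
    unbridged _ here = x₁≢x₂ ∘ sym , λ (_ , x₂≢x₂) → contradiction refl x₂≢x₂
    unbridged ¬bridge {s} (step {w = w} sw walk) with place w | unbridged ¬bridge walk
    ... | at-x₁ refl | w≢x₁ , _ = contradiction refl w≢x₁
    ... | at-x₂ refl | _ = (λ { refl → x₁≁x₂ sw }) , λ is → s , (is , refl) , sw
    ... | inner iw | _ , reach =
      (λ { refl → let u , mu , u₂ = reach iw in ¬bridge (w , u , iw , mu , Adj-sym G sw , u₂) }) ,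
      λ is → let u , (iu , cu) , u₂ = reach iw
             in u , (iu , trans cu (adj⇒sameClique is iw sw)) , u₂

  -- x₁ and x₂ both get colour 0; α is the only neighbour of x₁ coloured 1 and β the only
  -- neighbour of x₂ coloured 2.

  data BridgeShape (c : ℕ) : Set where
    split   : ∀ z a → Member c z → ¬ N₁ z → Member c a → ¬ N₂ a → a ≢ z → BridgeShape c
    within₁ : (∀ u → Member c u → N₁ u) → BridgeShape c
    within₂ : (∀ u → Member c u → N₂ u) → BridgeShape c

  bridgeSplit : ¬ CommonNeighbour → ∀ {c} →
    (∃ λ z → Member c z × ¬ N₁ z) → (∃ λ a → Member c a × ¬ N₂ a) → BridgeShape c
  bridgeSplit ¬common (z , mz , ¬z₁) (a , ma , ¬a₂) with a ≟ z
  ... | no a≢z = split z a mz ¬z₁ ma ¬a₂ a≢z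
  ... | yes refl with meetsX mz
  ...   | w , mw , inj₁ w₁ = split z w mz ¬z₁ mw (λ w₂ → ¬common (w , proj₁ mw , w₁ , w₂))
                               (≢detached (inj₁ w₁) (¬z₁ , ¬a₂))
  ...   | w , mw , inj₂ w₂ = split w z mw (λ w₁ → ¬common (w , proj₁ mw , w₁ , w₂)) mz ¬a₂
                               (≢detached (inj₂ w₂) (¬z₁ , ¬a₂) ∘ sym)

  bridgeShape : ¬ CommonNeighbour → ∀ c → BridgeShape c
  bridgeShape ¬common c
    with all? (λ u → Member? c u →-dec N₁? u) | all? (λ u → Member? c u →-dec N₂? u)
  ... | yes all₁ | _        = within₁ all₁
  ... | no _     | yes all₂ = within₂ all₂
  ... | no ¬all₁ | no ¬all₂ =
    bridgeSplit ¬common (¬all⇒counterexample N₁? ¬all₁) (¬all⇒counterexample N₂? ¬all₂)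

  paintBridge : ∀ {c} → BridgeShape c → Fin n → Fin 3
  paintBridge (split z a _ _ _ _ _) = highlight₂ z 1F a 2F 0F
  paintBridge (within₁ _)           = λ _ → 2F
  paintBridge (within₂ _)           = λ _ → 1F

  bridgeHighlight-lcf : ∀ {c a b} → Member c a → Member c b → b ≢ a →
    LocallyConflictFree 0F 0F c (highlight₂ a 1F b 2F 0F)
  bridgeHighlight-lcf {a = a} ma mb b≢a v mv with v ≟ a
  ... | yes refl = highlight₂-witness₂ mb mv (b≢a ∘ sym) b≢a (λ ()) (λ ()) (λ _ ()) (λ _ ())
  ... | no v≢a   = highlight₂-witness₁ ma mv v≢a (λ ()) (λ ()) (λ _ ()) (λ _ ())

  paintBridge-lcf : ¬ CommonNeighbour → ∀ {c} (σ : BridgeShape c) →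
    LocallyConflictFree 0F 0F c (paintBridge σ)
  paintBridge-lcf _ (split z a mz _ ma _ a≢z) = bridgeHighlight-lcf mz ma a≢z
  paintBridge-lcf ¬common (within₁ all₁) v mv =
    viaX₁ (all₁ v mv) (λ v₂ _ → ¬common (v , proj₁ mv , all₁ v mv , v₂)) (λ _ _ ())
  paintBridge-lcf ¬common (within₂ all₂) v mv =
    viaX₂ (all₂ v mv) (λ v₁ _ → ¬common (v , proj₁ mv , v₁ , all₂ v mv)) (λ _ _ ())

  paintBridge-one : ¬ CommonNeighbour → ∀ {c} (σ : BridgeShape c) u → Member c u →
    paintBridge σ u ≡ 1F → ¬ N₁ u
  paintBridge-one _ (split z a _ ¬z₁ _ _ _) u _ e =
    subst (¬_ ∘ N₁) (sym (highlight₂-unique₁ {a = z} {b = a} (λ ()) (λ ()) e)) ¬z₁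
  paintBridge-one _ (within₁ _) u _ ()
  paintBridge-one ¬common (within₂ all₂) u mu _ u₁ = ¬common (u , proj₁ mu , u₁ , all₂ u mu)

  paintBridge-two : ¬ CommonNeighbour → ∀ {c} (σ : BridgeShape c) u → Member c u →
    paintBridge σ u ≡ 2F → ¬ N₂ u
  paintBridge-two _ (split z a _ _ _ ¬a₂ _) u _ e =
    subst (¬_ ∘ N₂) (sym (highlight₂-unique₂ {a = z} {b = a} (λ ()) (λ ()) e)) ¬a₂
  paintBridge-two ¬common (within₁ all₁) u mu _ u₂ = ¬common (u , proj₁ mu , all₁ u mu , u₂)
  paintBridge-two _ (within₂ _) u _ ()

  bridged : ¬ Adj G x₁ x₂ → ¬ CommonNeighbour → χON≤ G 3
  bridged x₁≁x₂ ¬common with bridge x₁≁x₂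
  ... | α , β , iα , mβ@(iβ , cβ) , α₁ , β₂ =
    cfon C (x₁-witness C α (Adj-sym G α₁) Cα (λ x₁x₂ _ → contradiction x₁x₂ x₁≁x₂) ones)
           (x₂-witness C β (Adj-sym G β₂) Cβ
              (λ x₂x₁ _ → contradiction (Adj-sym G x₂x₁) x₁≁x₂) twos)
           (colouring-inner-witness 0F 0F F
              (overlay-lcf (bridgeHighlight-lcf (iα , refl) mβ β≢α) D-lcf))
    where
    β≢α : β ≢ α
    β≢α refl = ¬common (α , iα , α₁ , β₂)
    W : Fin n → Fin 3
    W = highlight₂ α 1F β 2F 0F
    D F : ℕ → Fin n → Fin 3
    D c = paintBridge (bridgeShape ¬common c)
    F = overlay (cl α) W D
    D-lcf : ∀ c → LocallyConflictFree 0F 0F c (D c)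
    D-lcf c = paintBridge-lcf ¬common (bridgeShape ¬common c)
    C : Fin n → Fin 3
    C = colouring 0F 0F F
    Cα : C α ≡ 1F
    Cα = trans (colouring-inner 0F 0F F iα)
           (trans (overlay-here (cl α) W D α) (highlight₂-first α))
    Cβ : C β ≡ 2F
    Cβ = trans (colouring-inner 0F 0F F iβ)
           (trans (cong (λ c → F c β) cβ)
             (trans (overlay-here (cl α) W D β) (highlight₂-second β β≢α)))
    ones : ∀ w → Inner w → N₁ w → C w ≡ 1F → w ≡ α
    ones w iw w₁ Cw = overlay-fibre (λ u → N₁ u → u ≡ α)
      (λ u _ Wu _ → highlight₂-unique₁ (λ ()) (λ ()) Wu)
      (λ c u mu Du u₁ → contradiction u₁ (paintBridge-one ¬common (bridgeShape ¬common c) u mu Du))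
      w iw Cw w₁
    twos : ∀ w → Inner w → N₂ w → C w ≡ 2F → w ≡ β
    twos w iw w₂ Cw = overlay-fibre (λ u → N₂ u → u ≡ β)
      (λ u _ Wu _ → highlight₂-unique₂ (λ ()) (λ ()) Wu)
      (λ c u mu Du u₂ → contradiction u₂ (paintBridge-two ¬common (bridgeShape ¬common c) u mu Du))
      w iw Cw w₂

module Cases {n : ℕ} (G : Graph n) (connected : Connected G)
             (x₁ x₂ : Fin n) (x₁≢x₂ : x₁ ≢ x₂)
             (cliques : DisjointUnionOfCliquesOutside G x₁ x₂) where

  open Cluster G connected x₁ x₂ x₁≢x₂ cliques
  module Swapped = Cluster G connected x₂ x₁ (x₁≢x₂ ∘ sym) (swapCliques {G = G} cliques)

  swapMember : ∀ {c u} → Member c u → Swapped.Member c u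
  swapMember = map₁ swap

  adjacent : Adj G x₁ x₂ → χON≤ G 3
  adjacent x₁x₂ with loose? | commonNeighbour? | Swapped.loose?
  ... | yes (y , iy , y₁ , ¬y₂ , r , mr , ¬r₁) | _ | _ =
    escaping y r iy y₁ mr ¬r₁ (inj₁ (x₁x₂ , ¬y₂))
  ... | no ¬loose | yes common | _ = sharedNeighbour (¬loose⇒closed ¬loose) common
  ... | no _ | no _ | yes (y , iy , y₂ , ¬y₁ , r , mr , ¬r₂) =
    Swapped.escaping y r iy y₂ mr ¬r₂ (inj₁ (Adj-sym G x₁x₂ , ¬y₁))
  ... | no ¬loose | no ¬common | no ¬loose₂ =
    separated x₁x₂ ¬common (¬loose⇒closed ¬loose) λ c a r ma a₂ ¬a₁ mr →
      Swapped.¬loose⇒closed ¬loose₂ c a r (swapMember ma) a₂ ¬a₁ (swapMember mr)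

  nonAdjacent : ¬ Adj G x₁ x₂ → χON≤ G 3
  nonAdjacent x₁≁x₂ with commonNeighbour?
  ... | no ¬common = bridged x₁≁x₂ ¬common
  ... | yes (y , iy , y₁ , y₂) with escapes? y | Swapped.escapes? y
  ...   | yes (r , mr , ¬r₁) | _ = escaping y r iy y₁ mr ¬r₁ (inj₂ (x₁≁x₂ , y₂))
  ...   | no _ | yes (r , mr , ¬r₂) =
    Swapped.escaping y r (swap iy) y₂ mr ¬r₂ (inj₂ (x₁≁x₂ ∘ Adj-sym G , y₁))
  ...   | no _ | no ¬escapes₂ = insideBoth x₁≁x₂ y iy y₁ λ u mu →
    decidable-stable (N₂? u) λ ¬u₂ → ¬escapes₂ (u , swapMember mu , ¬u₂)

-- The hypothesis 2 ≤ n is implied by x₁ ≢ x₂.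
lemma4 : ∀ {n : ℕ} (G : Graph n) → 2 ≤ n → Connected G →
    (x₁ x₂ : Fin n) → x₁ ≢ x₂ →
    DisjointUnionOfCliquesOutside G x₁ x₂ →
    χON≤ G 3
lemma4 G _ connected x₁ x₂ x₁≢x₂ cliques with Adj? G x₁ x₂
... | yes x₁x₂ = Cases.adjacent G connected x₁ x₂ x₁≢x₂ cliques x₁x₂
... | no x₁≁x₂ = Cases.nonAdjacent G connected x₁ x₂ x₁≢x₂ cliques x₁≁x₂
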